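{- Let $G$ be a connected non-bipartite graph of order $n$ with domination number $\gamma$. Then $G$ contains a spanning subgraph that is unicyclic, non-bipartite, and has domination number $\gamma$.
   Context: All graphs are finite and simple. The domination number $\gamma(G)$ is the minimum size of a set $S\subseteq V(G)$ such that every vertex outside $S$ has a neighbor in $S$. A graph is unicyclic if it is connected and contains exactly one cycle. -}

module Defs where

open import Data.Nat using (ℕ; zero; suc; _+_; _≤_)
open import Data.Fin using (Fin; zero; suc)
open import Data.Bool using (Bool; true; false)
open import Data.Product using (Σ; ∃; _×_; _,_)
open import Data.Sum using (_⊎_)
open import Relation.Nullary using (¬_)
open import Relation.Binary.PropositionalEquality using (_≡_; _≢_)

Rel₂ : ℕ → Set
Rel₂ n = Fin n → Fin n → Bool

record Graph (n : ℕ) : Set where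
  field
    adj   : Rel₂ n
    sym   : ∀ u v → adj u v ≡ true → adj v u ≡ true
    irref : ∀ v → adj v v ≡ false
open Graph public

count : {n : ℕ} → (Fin n → Bool) → ℕ
count {zero}  p = 0
count {suc n} p with p zero
... | true  = suc (count (λ i → p (suc i)))
... | false = count (λ i → p (suc i))

data Reach {n : ℕ} (E : Rel₂ n) : Fin n → Fin n → Set where
  here : ∀ {v} → Reach E v v
  step : ∀ {u w v} → E u w ≡ true → Reach E w v → Reach E u v

Connected : {n : ℕ} → Graph n → Set
Connected G = ∀ u v → Reach (adj G) u v

Bipartite : {n : ℕ} → Graph n → Set
Bipartite {n} G = Σ (Fin n → Bool) λ c → ∀ u v → adj G u v ≡ true → c u ≢ c v

SpanningSubgraph : {n : ℕ} → Graph n → Graph n → Set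
SpanningSubgraph H G = ∀ u v → adj H u v ≡ true → adj G u v ≡ true

deg : {n : ℕ} → Rel₂ n → Fin n → ℕ
deg E v = count (E v)

-- C is (the edge set of) a cycle of G: C is a symmetric set of edges of G,
-- nonempty, every vertex has C-degree 0 or 2, and the vertices of C-degree 2
-- are mutually connected by walks using C-edges.
-- (A connected 2-regular simple graph is exactly a cycle, of length ≥ 3.)
IsCycle : {n : ℕ} → Graph n → Rel₂ n → Set
IsCycle {n} G C =
  (∀ u v → C u v ≡ true → adj G u v ≡ true) ×
  (∀ u v → C u v ≡ true → C v u ≡ true) ×
  (Σ (Fin n) λ u → Σ (Fin n) λ v → C u v ≡ true) ×
  (∀ v → deg C v ≡ 0 ⊎ deg C v ≡ 2) ×
  (∀ u v → deg C u ≡ 2 → deg C v ≡ 2 → Reach C u v)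

Unicyclic : {n : ℕ} → Graph n → Set
Unicyclic {n} G =
  Connected G ×
  Σ (Rel₂ n) λ C → IsCycle G C ×
    (∀ C' → IsCycle G C' → ∀ u v → C' u v ≡ C u v)

Dominating : {n : ℕ} → Graph n → (Fin n → Bool) → Set
Dominating {n} G S =
  ∀ v → S v ≡ false → Σ (Fin n) λ u → S u ≡ true × adj G u v ≡ true

DominationNumber : {n : ℕ} → Graph n → ℕ → Set
DominationNumber {n} G k =
  (Σ (Fin n → Bool) λ S → Dominating G S × count S ≡ k) ×
  (∀ S → Dominating G S → k ≤ count S)

module Submission where

-- Take a minimum dominating set S and grow a spanning tree T of G in which every vertex outside S
-- is adjacent to a vertex of S: each vertex joins the cluster (a star) of one of its dominators,
-- and the clusters are linked by a breadth-first search over clusters.  Colouring T by depth parity is proper,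
-- so, G not being bipartite, some edge ab of G joins two vertices of equal depth parity.  Then
-- T + ab is unicyclic, its cycle (the tree paths from a and b to their meeting point, plus ab)
-- is odd, and S still dominates it.  No smaller set does, since a dominating set of a spanning
-- subgraph dominates G.

open import Defs hiding (sym)
open import Data.Nat using (ℕ; zero; suc; _+_; _*_; _∸_; _≤_; _<_; _⊔_; z≤n; s≤s; pred; _≤?_)
open import Data.Nat.Properties hiding (_≟_)
open import Data.Fin using (Fin; zero; suc; _≟_)
import Data.Fin.Properties as Finₚ
open import Data.Fin.Properties using (any?)
open import Data.Bool using (Bool; true; false; _∧_; not; _xor_)
open import Data.Bool.Properties using (¬-not; not-¬; not-involutive; ∧-identityʳ) renaming (_≟_ to _≟ᴮ_)
open import Data.Product using (Σ; ∃; _×_; _,_; proj₁; proj₂)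
open import Data.Sum using (_⊎_; inj₁; inj₂; [_,_]; swap)
open import Data.Empty using (⊥; ⊥-elim)
open import Function using (_∘_)
open import Relation.Nullary using (¬_; Dec; yes; no; does; contradiction)
open import Relation.Nullary.Decidable using (dec-true; dec-false; decidable-stable; map′; _×-dec_; _⊎-dec_; ¬?)
open import Relation.Binary.PropositionalEquality hiding ([_])

bool-ext : ∀ {x y} → (x ≡ true → y ≡ true) → (y ≡ true → x ≡ true) → x ≡ y
bool-ext {true}          x⇒y _   = sym (x⇒y refl)
bool-ext {false} {true}  _   y⇒x = y⇒x refl
bool-ext {false} {false} _   _   = refl

true≢false : ∀ {b} → b ≡ true → b ≢ false
true≢false refl ()

does⇒ : ∀ {P : Set} (P? : Dec P) → does P? ≡ true → P
does⇒ (yes p) _ = p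

_⊆ᵇ_ : ∀ {n} → (Fin n → Bool) → (Fin n → Bool) → Set
p ⊆ᵇ q = ∀ i → p i ≡ true → q i ≡ true

count-cong : ∀ {n} {p q : Fin n → Bool} → p ≗ q → count p ≡ count q
count-cong {zero}          _   = refl
count-cong {suc n} {p} {q} p≗q with p zero | q zero | p≗q zero
... | true  | true  | _ = cong suc (count-cong (p≗q ∘ suc))
... | false | false | _ = count-cong (p≗q ∘ suc)

count-mono : ∀ {n} {p q : Fin n → Bool} → p ⊆ᵇ q → count p ≤ count q
count-mono {zero}          _   = z≤n
count-mono {suc n} {p} {q} p⊆q with p zero | q zero | p⊆q zero
... | true  | true  | _   = s≤s (count-mono (p⊆q ∘ suc))
... | true  | false | p⊆q₀ with () ← p⊆q₀ refl
... | false | true  | _   = m≤n⇒m≤1+n (count-mono (p⊆q ∘ suc))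
... | false | false | _   = count-mono (p⊆q ∘ suc)

count-pos : ∀ {n} {p : Fin n → Bool} i → p i ≡ true → 1 ≤ count p
count-pos {suc n} {p} i pi with p zero in p₀
... | true = s≤s z≤n
count-pos {suc n} {p} zero    pi | false with () ← trans (sym pi) p₀
count-pos {suc n} {p} (suc i) pi | false = count-pos {p = p ∘ suc} i pi

count-none : ∀ {n} {p : Fin n → Bool} → (∀ i → p i ≡ false) → count p ≡ 0
count-none {zero}      _     = refl
count-none {suc n} {p} p≡false with p zero | p≡false zero
... | false | _ = count-none (p≡false ∘ suc)

count≤1 : ∀ {n} {p : Fin n → Bool} j → (∀ i → p i ≡ true → i ≡ j) → count p ≤ 1
count≤1 {suc n} {p} j only-j with p zero in p₀
... | true = s≤s (≤-reflexive (count-none λ i → ¬-not λ pi →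
                 Finₚ.0≢1+n (trans (only-j zero p₀) (sym (only-j (suc i) pi)))))
count≤1 {suc n} {p} zero    only-j | false =
  ≤-trans (≤-reflexive (count-none λ i → ¬-not λ pi → Finₚ.0≢1+n (sym (only-j (suc i) pi)))) z≤n
count≤1 {suc n} {p} (suc j) only-j | false =
  count≤1 {p = p ∘ suc} j (λ i pi → Finₚ.suc-injective (only-j (suc i) pi))

_∖_ : ∀ {n} → (Fin n → Bool) → Fin n → Fin n → Bool
(p ∖ i) k = p k ∧ not (does (k ≟ i))

count-remove : ∀ {n} {p : Fin n → Bool} i → p i ≡ true → count p ≡ suc (count (p ∖ i))
count-remove {suc n} {p} zero pi with p zero
... | true  = cong suc (count-cong λ k → sym (∧-identityʳ (p (suc k))))
count-remove {suc n} {p} (suc i) pi with p zero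
... | true  = cong suc (count-remove {p = p ∘ suc} i pi)
... | false = count-remove {p = p ∘ suc} i pi

count≡1 : ∀ {n} {p : Fin n → Bool} j → p j ≡ true → (∀ i → p i ≡ true → i ≡ j) → count p ≡ 1
count≡1 {p = p} j pj only-j = ≤-antisym (count≤1 j only-j) (count-pos {p = p} j pj)

count≡2 : ∀ {n} {p : Fin n → Bool} i j → i ≢ j → p i ≡ true → p j ≡ true →
          (∀ k → p k ≡ true → k ≡ i ⊎ k ≡ j) → count p ≡ 2
count≡2 {p = p} i j i≢j pi pj only-ij =
  trans (count-remove i pi) (cong suc (count≡1 j (cong₂ (λ x y → x ∧ not y) pj (dec-false (j ≟ i) (i≢j ∘ sym))) only-j))
  where
  only-j : ∀ k → (p ∖ i) k ≡ true → k ≡ j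
  only-j k pk with p k in p-k | k ≟ i
  ... | true | no k≢i with only-ij k p-k
  ...   | inj₁ k≡i = ⊥-elim (k≢i k≡i)
  ...   | inj₂ k≡j = k≡j

count-≤⇒⊇ : ∀ {n} {p q : Fin n → Bool} → p ⊆ᵇ q → count q ≤ count p → q ⊆ᵇ p
count-≤⇒⊇ {suc n} {p} {q} p⊆q q≤p i qi with p zero in p₀ | q zero in q₀
... | true  | false with () ← trans (sym (p⊆q zero p₀)) q₀
... | false | true  = ⊥-elim (1+n≰n (≤-trans (s≤s (count-mono (p⊆q ∘ suc))) q≤p))
count-≤⇒⊇ {suc n} {p} {q} p⊆q q≤p zero    qi | true  | true  = p₀
count-≤⇒⊇ {suc n} {p} {q} p⊆q q≤p (suc i) qi | true  | true  =
  count-≤⇒⊇ {p = p ∘ suc} (p⊆q ∘ suc) (≤-pred q≤p) i qi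
count-≤⇒⊇ {suc n} {p} {q} p⊆q q≤p zero    qi | false | false with () ← trans (sym qi) q₀
count-≤⇒⊇ {suc n} {p} {q} p⊆q q≤p (suc i) qi | false | false =
  count-≤⇒⊇ {p = p ∘ suc} (p⊆q ∘ suc) q≤p i qi

module _ {n : ℕ} {E : Rel₂ n} where

  Reach-trans : ∀ {x y z} → Reach E x y → Reach E y z → Reach E x z
  Reach-trans here        q = q
  Reach-trans (step e xy) q = step e (Reach-trans xy q)

  Reach-sym : (∀ u w → E u w ≡ true → E w u ≡ true) → ∀ {x y} → Reach E x y → Reach E y x
  Reach-sym E-sym here                = here
  Reach-sym E-sym (step {u} {w} e wy) = Reach-trans (Reach-sym E-sym wy) (step (E-sym u w e) here)

  Reach-map : ∀ {E′ : Rel₂ n} → (∀ u w → E u w ≡ true → E′ u w ≡ true) → ∀ {x y} → Reach E x y → Reach E′ x y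
  Reach-map E⊆E′ here                = here
  Reach-map E⊆E′ (step {u} {w} e wy) = step (E⊆E′ u w e) (Reach-map E⊆E′ wy)

monochromatic-edge : ∀ {n} (G : Graph n) (c : Fin n → Bool) → ¬ Bipartite G →
                     ∃ λ a → ∃ λ b → adj G a b ≡ true × c a ≡ c b
monochromatic-edge G c not-bipartite with any? (λ a → any? λ b → adj G a b ≟ᴮ true ×-dec c a ≟ᴮ c b)
... | yes edge = edge
... | no none  = ⊥-elim (not-bipartite (c , λ u v uv same → none (u , v , uv , same)))

domination-number-spanning : ∀ {n} {G H : Graph n} {γ S} → SpanningSubgraph H G → DominationNumber G γ →
                             Dominating H S → count S ≡ γ → DominationNumber H γ
domination-number-spanning H⊆G (_ , γ-min) S-dom |S|≡γ = (_ , S-dom , |S|≡γ) , λ S′ S′-dom → γ-min S′ λ v v∉S′ →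
  let (u , u∈S′ , uv) = S′-dom v v∉S′ in u , u∈S′ , H⊆G u v uv

least : ∀ {P : ℕ → Set} → (∀ k → Dec (P k)) → ∀ {m} → P m → Σ ℕ λ k → P k × (∀ {j} → P j → k ≤ j)
least P? {zero}  p0 = 0 , p0 , λ _ → z≤n
least P? {suc m} pm with P? zero
... | yes p0 = 0 , p0 , λ _ → z≤n
... | no ¬p0 with least (P? ∘ suc) pm
...   | k , pk , k-min = suc k , pk , λ { {zero} p0 → ⊥-elim (¬p0 p0) ; {suc j} pj → s≤s (k-min pj) }

maximum : ∀ {n} → (Fin n → ℕ) → ℕ
maximum {zero}  f = 0
maximum {suc n} f = f zero ⊔ maximum (f ∘ suc)

≤-maximum : ∀ {n} (f : Fin n → ℕ) i → f i ≤ maximum f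
≤-maximum f zero    = m≤m⊔n _ _
≤-maximum f (suc i) = ≤-trans (≤-maximum (f ∘ suc) i) (m≤n⊔m _ _)

odd : ℕ → Bool
odd zero    = false
odd (suc k) = not (odd k)

module RootedTree {n : ℕ} (r : Fin n) (parent : Fin n → Fin n) (parent-root : parent r ≡ r)
                  (rank : Fin n → ℕ) (rank-parent : ∀ v → v ≢ r → rank (parent v) < rank v) where

  -- Abstract, so that with-abstractions over _≟_ do not unfold depth in the types of hypotheses.
  abstract
    private
      depthWithin : ℕ → Fin n → ℕ
      depthWithin zero    v = 0
      depthWithin (suc f) v with v ≟ r
      ... | yes _ = 0
      ... | no  _ = suc (depthWithin f (parent v))

      depthWithin-stable : ∀ f f′ v → rank v < f → rank v < f′ → depthWithin f v ≡ depthWithin f′ v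
      depthWithin-stable (suc f) (suc f′) v rv<f rv<f′ with v ≟ r
      ... | yes _  = refl
      ... | no v≢r = cong suc (depthWithin-stable f f′ (parent v)
                       (<-≤-trans (rank-parent v v≢r) (≤-pred rv<f)) (<-≤-trans (rank-parent v v≢r) (≤-pred rv<f′)))

    depth : Fin n → ℕ
    depth v = depthWithin (suc (rank v)) v

    depth-root : depth r ≡ 0
    depth-root with r ≟ r
    ... | yes _  = refl
    ... | no r≢r = ⊥-elim (r≢r refl)

    depth-parent : ∀ v → v ≢ r → depth v ≡ suc (depth (parent v))
    depth-parent v v≢r with v ≟ r
    ... | yes v≡r = ⊥-elim (v≢r v≡r)
    ... | no _    = cong suc (depthWithin-stable (rank v) (suc (rank (parent v))) (parent v) (rank-parent v v≢r) ≤-refl)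

  depth≡0⇒root : ∀ {v} → depth v ≡ 0 → v ≡ r
  depth≡0⇒root {v} dv = decidable-stable (v ≟ r) λ v≢r → 1+n≢0 (trans (sym (depth-parent v v≢r)) dv)

  depth≡suc⇒non-root : ∀ {v k} → depth v ≡ suc k → v ≢ r
  depth≡suc⇒non-root dv refl = 1+n≢0 (trans (sym dv) depth-root)

  depth-induction : ∀ {ℓ} (P : Fin n → Set ℓ) → P r → (∀ v → v ≢ r → P (parent v) → P v) → ∀ v → P v
  depth-induction P P-root P-step v = go (depth v) v refl
    where
    go : ∀ k v → depth v ≡ k → P v
    go zero    v dv = subst P (sym (depth≡0⇒root dv)) P-root
    go (suc k) v dv = P-step v v≢r (go k (parent v) (suc-injective (trans (sym (depth-parent v v≢r)) dv)))
      where
      v≢r : v ≢ r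
      v≢r = depth≡suc⇒non-root dv

  Child : Fin n → Fin n → Set
  Child c x = c ≢ r × parent c ≡ x

  depth-child : ∀ {c x} → Child c x → depth c ≡ suc (depth x)
  depth-child (c≢r , refl) = depth-parent _ c≢r

  child-parity : ∀ {c x} → Child c x → odd (depth c) ≢ odd (depth x)
  child-parity c↑x eq = not-¬ refl (trans (sym eq) (cong odd (depth-child c↑x)))

  same-parity⇒¬parent : ∀ {a b} → odd (depth a) ≡ odd (depth b) → a ≢ b → parent a ≢ b
  same-parity⇒¬parent {a} {b} same a≢b pa≡b with a ≟ r
  ... | yes refl = a≢b (trans (sym parent-root) pa≡b)
  ... | no a≢r   = child-parity (a≢r , pa≡b) same

  parity-colouring : (c : Fin n → Bool) → (∀ v → v ≢ r → c v ≢ c (parent v)) →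
                     ∀ v → c v ≡ odd (depth v) xor c r
  parity-colouring c proper = depth-induction (λ v → c v ≡ odd (depth v) xor c r)
    (cong (_xor c r) (cong odd (sym depth-root)))
    λ v v≢r c[pv] → begin
      c v                                ≡⟨ ¬-not (proper v v≢r) ⟩
      not (c (parent v))                 ≡⟨ cong not c[pv] ⟩
      not (odd (depth (parent v)) xor c r) ≡⟨ not-xor (odd (depth (parent v))) (c r) ⟩
      odd (suc (depth (parent v))) xor c r ≡⟨ cong (λ d → odd d xor c r) (sym (depth-parent v v≢r)) ⟩
      odd (depth v) xor c r              ∎
    where
    open ≡-Reasoning
    not-xor : ∀ x y → not (x xor y) ≡ not x xor y
    not-xor true  y = not-involutive y
    not-xor false y = refl

  ascend : ℕ → Fin n → Fin n
  ascend zero    v = v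
  ascend (suc k) v = ascend k (parent v)

  ascend-suc : ∀ k v → ascend (suc k) v ≡ parent (ascend k v)
  ascend-suc zero    v = refl
  ascend-suc (suc k) v = ascend-suc k (parent v)

  ascend-+ : ∀ k j v → ascend (k + j) v ≡ ascend j (ascend k v)
  ascend-+ zero    j v = refl
  ascend-+ (suc k) j v = ascend-+ k j (parent v)

  depth-ascend : ∀ k v → k ≤ depth v → depth (ascend k v) + k ≡ depth v
  depth-ascend zero    v _   = +-identityʳ _
  depth-ascend (suc k) v k<d = begin
    depth (ascend k (parent v)) + suc k ≡⟨ +-suc _ k ⟩
    suc (depth (ascend k (parent v)) + k) ≡⟨ cong suc (depth-ascend k (parent v) k≤dpv) ⟩
    suc (depth (parent v))                ≡⟨ sym (depth-parent v v≢r) ⟩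
    depth v                               ∎
    where
    open ≡-Reasoning
    v≢r : v ≢ r
    v≢r refl = contradiction (subst (suc k ≤_) depth-root k<d) λ ()
    k≤dpv : k ≤ depth (parent v)
    k≤dpv = ≤-pred (subst (suc k ≤_) (depth-parent v v≢r) k<d)

  -- x ≼ v: x is an ancestor of v or v itself.  The depth equation rules out overshooting the
  -- root, where ascend stalls (parent r ≡ r).
  _≼_ : Fin n → Fin n → Set
  x ≼ v = Σ ℕ λ k → ascend k v ≡ x × depth x + k ≡ depth v

  ≼-refl : ∀ v → v ≼ v
  ≼-refl v = 0 , refl , +-identityʳ _

  ≼-depth : ∀ {x v} → x ≼ v → depth x ≤ depth v
  ≼-depth {x} (k , _ , d) = subst (depth x ≤_) d (m≤m+n _ _)

  ≼-parent : ∀ {x v} → x ≼ v → parent x ≼ v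
  ≼-parent {x} {v} (k , e , d) with x ≟ r
  ... | yes refl = k , trans e (sym parent-root) , trans (cong (λ z → depth z + k) parent-root) d
  ... | no x≢r   = suc k , trans (ascend-suc k v) (cong parent e) ,
                   trans (+-suc (depth (parent x)) k) (trans (cong (_+ k) (sym (depth-parent x x≢r))) d)

  root-≼ : ∀ v → r ≼ v
  root-≼ v = depth v , depth≡0⇒root (+-cancelʳ-≡ (depth v) _ 0 (depth-ascend (depth v) v ≤-refl)) ,
             cong (_+ depth v) depth-root

  ≼-unique : ∀ {x y v} → x ≼ v → y ≼ v → depth x ≡ depth y → x ≡ y
  ≼-unique {x} (k , e , d) (k′ , e′ , d′) dx≡dy =
    trans (sym e) (trans (cong (λ z → ascend z _) k≡k′) e′)
    where
    k≡k′ : k ≡ k′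
    k≡k′ = +-cancelˡ-≡ (depth x) k k′ (trans d (trans (sym d′) (cong (_+ k′) (sym dx≡dy))))

  ≼-trans : ∀ {x y v} → x ≼ y → y ≼ v → x ≼ v
  ≼-trans {x} {y} {v} (j , e , d) (k , e′ , d′) = k + j ,
    trans (ascend-+ k j v) (trans (cong (ascend j) e′) e) ,
    (begin
      depth x + (k + j) ≡⟨ cong (depth x +_) (+-comm k j) ⟩
      depth x + (j + k) ≡⟨ sym (+-assoc (depth x) j k) ⟩
      depth x + j + k   ≡⟨ cong (_+ k) d ⟩
      depth y + k       ≡⟨ d′ ⟩
      depth v           ∎)
    where open ≡-Reasoning

  ≼-comparable : ∀ {x y v} → x ≼ v → y ≼ v → depth x ≤ depth y → x ≼ y
  ≼-comparable {x} {y} {v} (k , e , d) (k′ , e′ , d′) dx≤dy with m≤n⇒∃[o]m+o≡n dx≤dy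
  ... | j , dj = j , trans (cong (ascend j) (sym e′)) (trans (sym (ascend-+ k′ j v)) (trans (cong (λ z → ascend z v) k′+j≡k) e)) ,
                 dj
    where
    k′+j≡k : k′ + j ≡ k
    k′+j≡k = +-cancelˡ-≡ (depth x) _ _ (trans (trans (cong (depth x +_) (+-comm k′ j)) (sym (+-assoc (depth x) j k′)))
               (trans (cong (_+ k′) dj) (trans d′ (sym d))))

  ≼-child : ∀ {x v} → x ≼ v → x ≢ v → ∃ λ c → c ≼ v × Child c x
  ≼-child (zero , e , d) x≢v = ⊥-elim (x≢v (sym e))
  ≼-child {x} {v} (suc j , e , d) _ = ascend j v , (j , refl , dc) , depth≡suc⇒non-root dc′ , trans (sym (ascend-suc j v)) e
    where
    dc : depth (ascend j v) + j ≡ depth v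
    dc = depth-ascend j v (subst (j ≤_) d (≤-trans (n≤1+n j) (m≤n+m (suc j) (depth x))))
    dc′ : depth (ascend j v) ≡ suc (depth x)
    dc′ = +-cancelʳ-≡ j _ _ (trans dc (trans (sym d) (+-suc (depth x) j)))

  _≼?_ : ∀ x v → Dec (x ≼ v)
  x ≼? v = map′ from to (depth x ≤? depth v ×-dec ascend (depth v ∸ depth x) v ≟ x)
    where
    from : depth x ≤ depth v × ascend (depth v ∸ depth x) v ≡ x → x ≼ v
    from (dx≤dv , e) = depth v ∸ depth x , e , m+[n∸m]≡n dx≤dv
    to : x ≼ v → depth x ≤ depth v × ascend (depth v ∸ depth x) v ≡ x
    to x≼v@(k , e , d) =
      ≼-depth x≼v , trans (cong (λ z → ascend z v) (trans (cong (_∸ depth x) (sym d)) (m+n∸m≡n (depth x) k))) e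

  child? : ∀ c x → Dec (Child c x)
  child? c x = ¬? (c ≟ r) ×-dec parent c ≟ x

  child-⋠-parent : ∀ {c x} → Child c x → ¬ c ≼ x
  child-⋠-parent c↑x c≼x = 1+n≰n (subst (_≤ _) (depth-child c↑x) (≼-depth c≼x))

  child-⋠ : ∀ {c x y} → Child c x → ¬ x ≼ y → ¬ c ≼ y
  child-⋠ (_ , refl) x⋠y c≼y = x⋠y (≼-parent c≼y)

  module PlusEdge (a b : Fin n) (parent-a≢b : parent a ≢ b) where

    data Edge (u w : Fin n) : Set where
      up   : Child u w → Edge u w
      down : Child w u → Edge u w
      ab   : u ≡ a → w ≡ b → Edge u w
      ba   : u ≡ b → w ≡ a → Edge u w

    Edge-sym : ∀ {u w} → Edge u w → Edge w u
    Edge-sym (up u↑w)     = down u↑w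
    Edge-sym (down w↑u)   = up w↑u
    Edge-sym (ab u≡a w≡b) = ba w≡b u≡a
    Edge-sym (ba u≡b w≡a) = ab w≡a u≡b

    edge? : ∀ u w → Dec (Edge u w)
    edge? u w = map′
      (λ { (inj₁ (inj₁ u↑w)) → up u↑w ; (inj₁ (inj₂ w↑u)) → down w↑u
         ; (inj₂ (inj₁ (u≡a , w≡b))) → ab u≡a w≡b ; (inj₂ (inj₂ (u≡b , w≡a))) → ba u≡b w≡a })
      (λ { (up u↑w) → inj₁ (inj₁ u↑w) ; (down w↑u) → inj₁ (inj₂ w↑u)
         ; (ab u≡a w≡b) → inj₂ (inj₁ (u≡a , w≡b)) ; (ba u≡b w≡a) → inj₂ (inj₂ (u≡b , w≡a)) })
      ((child? u w ⊎-dec child? w u) ⊎-dec ((u ≟ a ×-dec w ≟ b) ⊎-dec (u ≟ b ×-dec w ≟ a)))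

    -- Abstract, so that u and w are inferable from adjᴴ u w ≡ true (likewise for cycle below).
    abstract
      adjᴴ : Rel₂ n
      adjᴴ u w = does (edge? u w)

      adjᴴ⇒ : ∀ {u w} → adjᴴ u w ≡ true → Edge u w
      adjᴴ⇒ {u} {w} = does⇒ (edge? u w)

      ⇒adjᴴ : ∀ {u w} → Edge u w → adjᴴ u w ≡ true
      ⇒adjᴴ {u} {w} = dec-true (edge? u w)

    Common : Fin n → Set
    Common c = c ≼ a × c ≼ b

    -- v lies on the tree path from a or from b up to their meeting point.
    OnCycle : Fin n → Set
    OnCycle v = (v ≼ a ⊎ v ≼ b) × ¬ (∃ λ c → Child c v × Common c)

    onCycle? : ∀ v → Dec (OnCycle v)
    onCycle? v = (v ≼? a ⊎-dec v ≼? b) ×-dec ¬? (any? λ c → child? c v ×-dec (c ≼? a ×-dec c ≼? b))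

    CycleEdge : Fin n → Fin n → Set
    CycleEdge u w = Edge u w × OnCycle u × OnCycle w

    abstract
      cycle : Rel₂ n
      cycle u w = does (edge? u w ×-dec (onCycle? u ×-dec onCycle? w))

      cycle⇒ : ∀ {u w} → cycle u w ≡ true → CycleEdge u w
      cycle⇒ {u} {w} = does⇒ (edge? u w ×-dec (onCycle? u ×-dec onCycle? w))

      ⇒cycle : ∀ {u w} → CycleEdge u w → cycle u w ≡ true
      ⇒cycle {u} {w} = dec-true (edge? u w ×-dec (onCycle? u ×-dec onCycle? w))

    cycle-sym : ∀ u w → cycle u w ≡ true → cycle w u ≡ true
    cycle-sym u w h with cycle⇒ h
    ... | uw , onu , onw = ⇒cycle (Edge-sym uw , onw , onu)

    common-parent : ∀ {c v} → Child c v → Common c → Common v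
    common-parent (_ , refl) (c≼a , c≼b) = ≼-parent c≼a , ≼-parent c≼b

    a-only⇒non-root : ∀ {v} → ¬ v ≼ b → v ≢ r
    a-only⇒non-root v⋠b refl = v⋠b (root-≼ b)

    onCycle-a : OnCycle a
    onCycle-a = inj₁ (≼-refl a) , λ (c , c↑a , c≼a , _) → child-⋠-parent c↑a c≼a

    onCycle-b : OnCycle b
    onCycle-b = inj₂ (≼-refl b) , λ (c , c↑b , _ , c≼b) → child-⋠-parent c↑b c≼b

    onCycle-a-only : ∀ {v} → v ≼ a → ¬ v ≼ b → OnCycle v
    onCycle-a-only v≼a v⋠b = inj₁ v≼a , λ (c , c↑v , _ , c≼b) → child-⋠ c↑v v⋠b c≼b

    onCycle-parent : ∀ {v} → v ≼ a → ¬ v ≼ b → OnCycle (parent v)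
    onCycle-parent {v} v≼a v⋠b = inj₁ (≼-parent v≼a) , λ (c , c↑pv , c≼a , c≼b) →
      v⋠b (subst (_≼ b) (≼-unique c≼a v≼a (trans (depth-child c↑pv) (sym (depth-parent v (a-only⇒non-root v⋠b))))) c≼b)

    -- Next v w: w follows v when the cycle is traversed from the meeting point down to a, then across to b.
    Next : Fin n → Fin n → Set
    Next v w = (v ≡ a × w ≡ b) ⊎ (v ≢ a × Child w v × w ≼ a × ¬ w ≼ b)

    next-unique : ∀ {v w w′} → Next v w → Next v w′ → w ≡ w′
    next-unique (inj₁ (_ , w≡b)) (inj₁ (_ , w′≡b))       = trans w≡b (sym w′≡b)
    next-unique (inj₁ (v≡a , _)) (inj₂ (v≢a , _))        = ⊥-elim (v≢a v≡a)
    next-unique (inj₂ (v≢a , _)) (inj₁ (v≡a , _))        = ⊥-elim (v≢a v≡a)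
    next-unique (inj₂ (_ , w↑v , w≼a , _)) (inj₂ (_ , w′↑v , w′≼a , _)) =
      ≼-unique w≼a w′≼a (trans (depth-child w↑v) (sym (depth-child w′↑v)))

    child⇒next : ∀ {v w} → Child w v → w ≼ a → OnCycle v → Next v w
    child⇒next {v} {w} w↑v w≼a (_ , no-common-child) =
      inj₂ (v≢a , w↑v , w≼a , λ w≼b → no-common-child (w , w↑v , w≼a , w≼b))
      where
      v≢a : v ≢ a
      v≢a refl = child-⋠-parent w↑v w≼a

    next-exists : ∀ {v} → v ≼ a → OnCycle v → ∃ λ w → Next v w × CycleEdge v w
    next-exists {v} v≼a onv with v ≟ a
    ... | yes refl = b , inj₁ (refl , refl) , ab refl refl , onv , onCycle-b
    ... | no v≢a with ≼-child v≼a v≢a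
    ...   | w , w≼a , w↑v = w , child⇒next w↑v w≼a onv , down w↑v , onv , onCycle-a-only w≼a w⋠b
      where
      w⋠b : ¬ w ≼ b
      w⋠b w≼b = proj₂ onv (w , w↑v , w≼a , w≼b)

    parent≢next : ∀ {v w} → ¬ v ≼ b → Next v w → parent v ≢ w
    parent≢next v⋠b (inj₁ (refl , refl)) = parent-a≢b
    parent≢next v⋠b (inj₂ (_ , w↑v , _)) refl = child-⋠-parent w↑v (≼-parent (≼-refl _))

    cycle-to-parent : ∀ {v} → v ≼ a → ¬ v ≼ b → cycle v (parent v) ≡ true
    cycle-to-parent v≼a v⋠b = ⇒cycle (up (a-only⇒non-root v⋠b , refl) , onCycle-a-only v≼a v⋠b , onCycle-parent v≼a v⋠b)

    deg-a-only : ∀ {v} → v ≼ a → ¬ v ≼ b → deg cycle v ≡ 2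
    deg-a-only {v} v≼a v⋠b with next-exists v≼a (onCycle-a-only v≼a v⋠b)
    ... | w , v→w , vw = count≡2 (parent v) w (parent≢next v⋠b v→w)
                           (cycle-to-parent v≼a v⋠b) (⇒cycle vw) neighbours
      where
      onv : OnCycle v
      onv = onCycle-a-only v≼a v⋠b
      neighbours : ∀ u → cycle v u ≡ true → u ≡ parent v ⊎ u ≡ w
      neighbours u h with cycle⇒ h
      ... | up (_ , refl) , _ = inj₁ refl
      ... | ab refl refl  , _ = inj₂ (next-unique (inj₁ (refl , refl)) v→w)
      ... | ba refl _     , _ = ⊥-elim (v⋠b (≼-refl b))
      ... | down u↑v , _ , (inj₁ u≼a , _) = inj₂ (next-unique (child⇒next u↑v u≼a onv) v→w)
      ... | down u↑v , _ , (inj₂ u≼b , _) = ⊥-elim (child-⋠ u↑v v⋠b u≼b)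

    ReachesMeet : Fin n → Set
    ReachesMeet v = ∃ λ m → (Common m × OnCycle m) × Reach cycle v m

    climb : ∀ v → v ≼ a → OnCycle v → ReachesMeet v
    climb = depth-induction _ (λ r≼a onr → r , ((r≼a , root-≼ b) , onr) , here) climb-step
      where
      climb-step : ∀ v → v ≢ r → (parent v ≼ a → OnCycle (parent v) → ReachesMeet (parent v)) →
                   v ≼ a → OnCycle v → ReachesMeet v
      climb-step v _ climb-parent v≼a onv with v ≼? b
      ... | yes v≼b = v , ((v≼a , v≼b) , onv) , here
      ... | no v⋠b with climb-parent (≼-parent v≼a) (onCycle-parent v≼a v⋠b)
      ...   | m , meet , walk = m , meet , step (cycle-to-parent v≼a v⋠b) walk

    -- As C-degrees are 0 or 2, a vertex with at most one possible C-neighbour is C-isolated.  This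
    -- isolates the vertices off the two paths (leaves first) and those above the meeting point
    -- (root first), so C ⊆ cycle.
    module UniqueCycle (C : Rel₂ n) (C⊆adjᴴ : ∀ u w → C u w ≡ true → adjᴴ u w ≡ true)
                       (C-sym : ∀ u w → C u w ≡ true → C w u ≡ true)
                       (C-deg : ∀ v → deg C v ≡ 0 ⊎ deg C v ≡ 2) where

      Isolated : Fin n → Set
      Isolated v = ∀ w → C v w ≡ false

      edge⇒deg2 : ∀ u w → C u w ≡ true → deg C u ≡ 2
      edge⇒deg2 u w h with C-deg u
      ... | inj₂ d≡2 = d≡2
      ... | inj₁ d≡0 = ⊥-elim (1+n≰n (subst (1 ≤_) d≡0 (count-pos {p = C u} w h)))

      isolated⇒deg≢2 : ∀ {u} → Isolated u → deg C u ≢ 2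
      isolated⇒deg≢2 {u} iso d≡2 = 1+n≢0 (trans (sym d≡2) (count-none {p = C u} iso))

      one-neighbour⇒isolated : ∀ u j → (∀ w → C u w ≡ true → w ≡ j) → Isolated u
      one-neighbour⇒isolated u j only-j w = ¬-not λ h →
        1+n≰n (subst (_≤ 1) (edge⇒deg2 u w h) (count≤1 {p = C u} j only-j))

      off-paths-step : ∀ {v} → ¬ v ≼ a → ¬ v ≼ b → (∀ {w} → Child w v → Isolated w) → Isolated v
      off-paths-step {v} v⋠a v⋠b children-isolated = one-neighbour⇒isolated v (parent v) only-parent
        where
        only-parent : ∀ w → C v w ≡ true → w ≡ parent v
        only-parent w h with adjᴴ⇒ (C⊆adjᴴ v w h)
        ... | up (_ , refl) = refl
        ... | down w↑v      = ⊥-elim (not-¬ (children-isolated w↑v v) (C-sym v w h))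
        ... | ab refl _     = ⊥-elim (v⋠a (≼-refl a))
        ... | ba refl _     = ⊥-elim (v⋠b (≼-refl b))

      isolated-off-paths : ∀ k v → suc (maximum depth) ≤ depth v + k → ¬ v ≼ a → ¬ v ≼ b → Isolated v
      isolated-off-paths zero    v deep _ _ =
        ⊥-elim (1+n≰n (≤-trans deep (subst (_≤ maximum depth) (sym (+-identityʳ (depth v))) (≤-maximum depth v))))
      isolated-off-paths (suc k) v deep v⋠a v⋠b = off-paths-step v⋠a v⋠b λ {w} w↑v →
        isolated-off-paths k w (subst (suc (maximum depth) ≤_) (trans (+-suc (depth v) k) (cong (_+ k) (sym (depth-child w↑v)))) deep)
          (child-⋠ w↑v v⋠a) (child-⋠ w↑v v⋠b)

      above-meet-step : ∀ {v c} → Child c v → Common c → (∀ {w} → Child v w → C w v ≡ false) → Isolated v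
      above-meet-step {v} {c} c↑v (c≼a , c≼b) no-parent-edge = one-neighbour⇒isolated v c only-c
        where
        only-c : ∀ w → C v w ≡ true → w ≡ c
        only-c w h with adjᴴ⇒ (C⊆adjᴴ v w h)
        ... | up v↑w        = ⊥-elim (not-¬ (no-parent-edge v↑w) (C-sym v w h))
        ... | ab refl _     = ⊥-elim (child-⋠-parent c↑v c≼a)
        ... | ba refl _     = ⊥-elim (child-⋠-parent c↑v c≼b)
        ... | down w↑v with w ≼? a | w ≼? b
        ...   | yes w≼a | _       = ≼-unique w≼a c≼a (trans (depth-child w↑v) (sym (depth-child c↑v)))
        ...   | no _    | yes w≼b = ≼-unique w≼b c≼b (trans (depth-child w↑v) (sym (depth-child c↑v)))
        ...   | no w⋠a  | no w⋠b  =
          ⊥-elim (not-¬ (isolated-off-paths _ w (m≤n+m _ _) w⋠a w⋠b v) (C-sym v w h))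

      isolated-above-meet : ∀ v {c} → Child c v → Common c → Isolated v
      isolated-above-meet = depth-induction _
        (λ c↑r common → above-meet-step c↑r common λ r↑w → ⊥-elim (proj₁ r↑w refl))
        λ v v≢r parent-isolated c↑v common → above-meet-step c↑v common λ { (_ , refl) →
          parent-isolated (v≢r , refl) (common-parent c↑v common) v }

      active⇒onCycle : ∀ u → deg C u ≡ 2 → OnCycle u
      active⇒onCycle u d≡2 = on-path , λ (c , c↑u , common) → isolated⇒deg≢2 (isolated-above-meet u c↑u common) d≡2
        where
        on-path : u ≼ a ⊎ u ≼ b
        on-path with u ≼? a | u ≼? b
        ... | yes u≼a | _       = inj₁ u≼a
        ... | no _    | yes u≼b = inj₂ u≼b
        ... | no u⋠a  | no u⋠b  = ⊥-elim (isolated⇒deg≢2 (isolated-off-paths _ u (m≤n+m _ _) u⋠a u⋠b) d≡2)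

      C⊆cycle : ∀ u w → C u w ≡ true → cycle u w ≡ true
      C⊆cycle u w h = ⇒cycle (adjᴴ⇒ (C⊆adjᴴ u w h) , active⇒onCycle u (edge⇒deg2 u w h) ,
                              active⇒onCycle w (edge⇒deg2 w u (C-sym u w h)))

  module TreeWithEdge (a b : Fin n) (a≢b : a ≢ b) (parent-a≢b : parent a ≢ b) (parent-b≢a : parent b ≢ a) where

    open PlusEdge a b parent-a≢b public
    -- The same graph seen from b; a cycle vertex has one cycle neighbour Next-wards from each side.
    module B = PlusEdge b a parent-b≢a

    edge-swap : ∀ {u w} → Edge u w → B.Edge u w
    edge-swap (up u↑w)     = B.up u↑w
    edge-swap (down w↑u)   = B.down w↑u
    edge-swap (ab u≡a w≡b) = B.ba u≡a w≡b
    edge-swap (ba u≡b w≡a) = B.ab u≡b w≡a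

    edge-unswap : ∀ {u w} → B.Edge u w → Edge u w
    edge-unswap (B.up u↑w)     = up u↑w
    edge-unswap (B.down w↑u)   = down w↑u
    edge-unswap (B.ab u≡b w≡a) = ba u≡b w≡a
    edge-unswap (B.ba u≡a w≡b) = ab u≡a w≡b

    onCycle-swap : ∀ {v} → OnCycle v → B.OnCycle v
    onCycle-swap (on-path , no-common) = swap on-path , λ (c , c↑v , c≼b , c≼a) → no-common (c , c↑v , c≼a , c≼b)

    onCycle-unswap : ∀ {v} → B.OnCycle v → OnCycle v
    onCycle-unswap (on-path , no-common) = swap on-path , λ (c , c↑v , c≼a , c≼b) → no-common (c , c↑v , c≼b , c≼a)

    cycle-swap : ∀ u w → cycle u w ≡ B.cycle u w
    cycle-swap u w = bool-ext
      (λ h → let (uw , onu , onw) = cycle⇒ h in B.⇒cycle (edge-swap uw , onCycle-swap onu , onCycle-swap onw))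
      (λ h → let (uw , onu , onw) = B.cycle⇒ h in ⇒cycle (edge-unswap uw , onCycle-unswap onu , onCycle-unswap onw))

    next-disjoint : ∀ {v w} → Next v w → B.Next v w → ⊥
    next-disjoint (inj₁ (refl , _))           (inj₁ (v≡b , _))            = a≢b v≡b
    next-disjoint (inj₁ (refl , refl))        (inj₂ (_ , (_ , b↑a) , _))  = parent-b≢a b↑a
    next-disjoint (inj₂ (_ , (_ , a↑b) , _))  (inj₁ (refl , refl))        = parent-a≢b a↑b
    next-disjoint (inj₂ (_ , _ , w≼a , _))    (inj₂ (_ , _ , _ , w⋠a))    = w⋠a w≼a

    deg-common : ∀ {v} → Common v → OnCycle v → deg cycle v ≡ 2
    deg-common {v} (v≼a , v≼b) onv with next-exists v≼a onv | B.next-exists v≼b (onCycle-swap onv)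
    ... | w , v→w , vw | w′ , v→′w′ , (vw′ , onv′ , onw′) =
      count≡2 w w′ (λ { refl → next-disjoint v→w v→′w′ }) (⇒cycle vw)
        (⇒cycle (edge-unswap vw′ , onCycle-unswap onv′ , onCycle-unswap onw′)) neighbours
      where
      neighbours : ∀ u → cycle v u ≡ true → u ≡ w ⊎ u ≡ w′
      neighbours u h with cycle⇒ h
      ... | up v↑u , _ , (_ , no-common) = ⊥-elim (no-common (v , v↑u , v≼a , v≼b))
      ... | ab refl refl , _ = inj₁ (next-unique (inj₁ (refl , refl)) v→w)
      ... | ba refl refl , _ = inj₂ (B.next-unique (inj₁ (refl , refl)) v→′w′)
      ... | down u↑v , _ , (inj₁ u≼a , _) = inj₁ (next-unique (child⇒next u↑v u≼a onv) v→w)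
      ... | down u↑v , _ , (inj₂ u≼b , _) = inj₂ (B.next-unique (B.child⇒next u↑v u≼b (onCycle-swap onv)) v→′w′)

    off-cycle⇒deg0 : ∀ {v} → ¬ OnCycle v → deg cycle v ≡ 0
    off-cycle⇒deg0 {v} v-off = count-none {p = cycle v} λ w → ¬-not λ h → v-off (proj₁ (proj₂ (cycle⇒ h)))

    cycle-deg : ∀ v → deg cycle v ≡ 0 ⊎ deg cycle v ≡ 2
    cycle-deg v with onCycle? v | v ≼? a | v ≼? b
    ... | no v-off | _       | _       = inj₁ (off-cycle⇒deg0 v-off)
    ... | yes onv  | yes v≼a | yes v≼b = inj₂ (deg-common (v≼a , v≼b) onv)
    ... | yes _    | yes v≼a | no v⋠b  = inj₂ (deg-a-only v≼a v⋠b)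
    ... | yes _    | no v⋠a  | yes v≼b = inj₂ (trans (count-cong (cycle-swap v)) (B.deg-a-only v≼b v⋠a))
    ... | yes onv  | no v⋠a  | no v⋠b  = ⊥-elim ([ v⋠a , v⋠b ] (proj₁ onv))

    cycle-edge⇒deg2 : ∀ u w → cycle u w ≡ true → deg cycle u ≡ 2
    cycle-edge⇒deg2 u w h with cycle-deg u
    ... | inj₂ d≡2 = d≡2
    ... | inj₁ d≡0 = ⊥-elim (1+n≰n (subst (1 ≤_) d≡0 (count-pos {p = cycle u} w h)))

    deg-cycle≤2 : ∀ v → deg cycle v ≤ 2
    deg-cycle≤2 v with cycle-deg v
    ... | inj₁ d≡0 = ≤-trans (≤-reflexive d≡0) z≤n
    ... | inj₂ d≡2 = ≤-reflexive d≡2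

    active⇒onCycle : ∀ {v} → deg cycle v ≡ 2 → OnCycle v
    active⇒onCycle {v} d≡2 = decidable-stable (onCycle? v) λ v-off → 1+n≢0 (trans (sym d≡2) (off-cycle⇒deg0 v-off))

    common-below : ∀ {x y} → Common x → OnCycle x → Common y → depth x ≤ depth y → x ≡ y
    common-below {x} {y} (x≼a , x≼b) (_ , no-common) (y≼a , y≼b) dx≤dy with x ≟ y
    ... | yes x≡y = x≡y
    ... | no x≢y with ≼-child (≼-comparable x≼a y≼a dx≤dy) x≢y
    ...   | c , c≼y , c↑x = ⊥-elim (no-common (c , c↑x , ≼-trans c≼y y≼a , ≼-trans c≼y y≼b))

    meet-unique : ∀ {x y} → Common x → OnCycle x → Common y → OnCycle y → x ≡ y
    meet-unique {x} {y} cx onx cy ony with ≤-total (depth x) (depth y)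
    ... | inj₁ dx≤dy = common-below cx onx cy dx≤dy
    ... | inj₂ dy≤dx = sym (common-below cy ony cx dy≤dx)

    reach-meet : ∀ {v} → OnCycle v → ReachesMeet v
    reach-meet {v} onv with proj₁ onv
    ... | inj₁ v≼a = climb v v≼a onv
    ... | inj₂ v≼b with B.climb v v≼b (onCycle-swap onv)
    ...   | m , ((m≼b , m≼a) , onm) , walk =
      m , ((m≼a , m≼b) , onCycle-unswap onm) , Reach-map (λ u w → subst (_≡ true) (sym (cycle-swap u w))) walk

    cycle-connected : ∀ u v → deg cycle u ≡ 2 → deg cycle v ≡ 2 → Reach cycle u v
    cycle-connected u v du dv with reach-meet (active⇒onCycle du) | reach-meet (active⇒onCycle dv)
    ... | m , (cm , onm) , u⇝m | m′ , (cm′ , onm′) , v⇝m′ =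
      Reach-trans u⇝m (subst (λ x → Reach cycle x v) (meet-unique cm′ onm′ cm onm) (Reach-sym cycle-sym v⇝m′))

    no-loop : ∀ {v} → ¬ Edge v v
    no-loop (up v↑v)       = child-⋠-parent v↑v (≼-refl _)
    no-loop (down v↑v)     = child-⋠-parent v↑v (≼-refl _)
    no-loop (ab v≡a v≡b)   = a≢b (trans (sym v≡a) v≡b)
    no-loop (ba v≡b v≡a)   = a≢b (trans (sym v≡a) v≡b)

    H : Graph n
    H = record { adj = adjᴴ ; sym = λ u w h → ⇒adjᴴ (Edge-sym (adjᴴ⇒ h)) ; irref = λ v → ¬-not (no-loop ∘ adjᴴ⇒) }

    H-connected : Connected H
    H-connected u v = Reach-trans (to-root u) (Reach-sym (Graph.sym H) (to-root v))
      where
      to-root : ∀ v → Reach adjᴴ v r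
      to-root = depth-induction _ here λ v v≢r pv⇝r → step (⇒adjᴴ (up (v≢r , refl))) pv⇝r

    cycle-isCycle : IsCycle H cycle
    cycle-isCycle = (λ u w h → ⇒adjᴴ (proj₁ (cycle⇒ h))) , cycle-sym ,
                    (a , b , ⇒cycle (ab refl refl , onCycle-a , onCycle-b)) , cycle-deg , cycle-connected

    -- C ⊆ cycle, with equality at C-active vertices as cycle-degrees are ≤ 2; and activity spreads
    -- along the connected cycle from any C-edge.
    cycle-unique : ∀ C → IsCycle H C → ∀ u v → C u v ≡ cycle u v
    cycle-unique C (C⊆H , C-sym , (u₀ , w₀ , u₀w₀) , C-deg , _) u v =
      bool-ext (C⊆cycle u v) λ h → full u (active u (cycle-edge⇒deg2 u v h)) v h
      where
      open UniqueCycle C C⊆H C-sym C-deg using (C⊆cycle; edge⇒deg2)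
      full : ∀ x → deg C x ≡ 2 → ∀ y → cycle x y ≡ true → C x y ≡ true
      full x d≡2 = count-≤⇒⊇ {p = C x} {q = cycle x} (C⊆cycle x) (subst (deg cycle x ≤_) (sym d≡2) (deg-cycle≤2 x))
      spread : ∀ {x y} → Reach cycle x y → deg C x ≡ 2 → deg C y ≡ 2
      spread here d≡2 = d≡2
      spread (step {x} {z} xz z⇝y) d≡2 = spread z⇝y (edge⇒deg2 z x (C-sym x z (full x d≡2 z xz)))
      active : ∀ x → deg cycle x ≡ 2 → deg C x ≡ 2
      active x d≡2 =
        spread (cycle-connected u₀ x (cycle-edge⇒deg2 u₀ w₀ (C⊆cycle u₀ w₀ u₀w₀)) d≡2) (edge⇒deg2 u₀ w₀ u₀w₀)

    H-unicyclic : Unicyclic H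
    H-unicyclic = H-connected , cycle , cycle-isCycle , cycle-unique

    H-nonBipartite : odd (depth a) ≡ odd (depth b) → ¬ Bipartite H
    H-nonBipartite same-parity (c , proper) = proper a b (⇒adjᴴ (ab refl refl)) (begin
      c a                      ≡⟨ parity-colouring c tree-proper a ⟩
      odd (depth a) xor c r    ≡⟨ cong (_xor c r) same-parity ⟩
      odd (depth b) xor c r    ≡⟨ sym (parity-colouring c tree-proper b) ⟩
      c b                      ∎)
      where
      open ≡-Reasoning
      tree-proper : ∀ v → v ≢ r → c v ≢ c (parent v)
      tree-proper v v≢r = proper v (parent v) (⇒adjᴴ (up (v≢r , refl)))

    H-spanning : ∀ (G : Graph n) → (∀ v → v ≢ r → adj G v (parent v) ≡ true) → adj G a b ≡ true → SpanningSubgraph H G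
    H-spanning G tree⊆G ab∈G u w h with adjᴴ⇒ h
    ... | up (u≢r , refl)   = tree⊆G u u≢r
    ... | down (w≢r , refl) = Graph.sym G w u (tree⊆G w w≢r)
    ... | ab refl refl      = ab∈G
    ... | ba refl refl      = Graph.sym G a b ab∈G

module Clusters {n : ℕ} (G : Graph n) (S : Fin n → Bool) (dom : Dominating G S) where

  private
    pick : ∀ v b → S v ≡ b → Fin n
    pick v true  _   = v
    pick v false v∉S = proj₁ (dom v v∉S)

  centre : Fin n → Fin n
  centre v = pick v (S v) refl

  centre-∈S : ∀ v → S (centre v) ≡ true
  centre-∈S v = go (S v) refl
    where
    go : ∀ b (v∈S : S v ≡ b) → S (pick v b v∈S) ≡ true
    go true  v∈S = v∈S
    go false v∉S = proj₁ (proj₂ (dom v v∉S))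

  centre-self : ∀ {v} → S v ≡ true → centre v ≡ v
  centre-self {v} v∈S = go (S v) refl v∈S
    where
    go : ∀ b (e : S v ≡ b) → b ≡ true → pick v b e ≡ v
    go true _ _ = refl

  centre-adj : ∀ {v} → S v ≡ false → adj G (centre v) v ≡ true
  centre-adj {v} v∉S = go (S v) refl v∉S
    where
    go : ∀ b (e : S v ≡ b) → b ≡ false → adj G (pick v b e) v ≡ true
    go false e _ = proj₂ (proj₂ (dom v e))

  centre-idem : ∀ v → centre (centre v) ≡ centre v
  centre-idem v = centre-self (centre-∈S v)

  ≢centre⇒∉S : ∀ {v} → v ≢ centre v → S v ≡ false
  ≢centre⇒∉S v≢c = ¬-not λ v∈S → v≢c (sym (centre-self v∈S))

module DominatedSpanningTree {n : ℕ} (G : Graph n) (connected : Connected G) (S : Fin n → Bool) (dom : Dominating G S)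
                             (r : Fin n) (r∈S : S r ≡ true) where

  open Clusters G S dom

  centre-root : centre r ≡ r
  centre-root = centre-self r∈S

  -- The cluster of c is the set of vertices w with centre w ≡ c.
  Linked : (Fin n → Set) → Fin n → Set
  Linked R c = ∃ λ w → centre w ≡ c × ∃ λ u → R (centre u) × adj G u w ≡ true

  -- Reached k c: the cluster with centre c is at most k cluster-steps from the cluster of r.
  Reached : ℕ → Fin n → Set
  Reached zero    c = c ≡ r
  Reached (suc k) c = Reached k c ⊎ Linked (Reached k) c

  reached? : ∀ k c → Dec (Reached k c)
  reached? zero    c = c ≟ r
  reached? (suc k) c = reached? k c ⊎-dec linked? c
    where
    linked? : ∀ c → Dec (Linked (Reached k) c)
    linked? c = any? λ w → centre w ≟ c ×-dec any? λ u → reached? k (centre u) ×-dec adj G u w ≟ᴮ true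

  reached-walk : ∀ {k u v} → Reached k (centre u) → Reach (adj G) u v → ∃ λ m → Reached m (centre v)
  reached-walk {k} u-reached here                  = k , u-reached
  reached-walk {k} u-reached (step {w = w} uw w⇝v) =
    reached-walk {suc k} (inj₂ (w , refl , _ , u-reached , uw)) w⇝v

  private
    level-data : ∀ v → Σ ℕ λ k → Reached k (centre v) × (∀ {j} → Reached j (centre v) → k ≤ j)
    level-data v = least (λ k → reached? k (centre v))
                         (proj₂ (reached-walk {0} centre-root (connected r v)))

  level : Fin n → ℕ
  level v = proj₁ (level-data v)

  level-reached : ∀ v → Reached (level v) (centre v)
  level-reached v = proj₁ (proj₂ (level-data v))

  level-minimal : ∀ v {k} → Reached k (centre v) → level v ≤ k
  level-minimal v = proj₂ (proj₂ (level-data v))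

  level-cong : ∀ {x y} → centre x ≡ centre y → level x ≡ level y
  level-cong {x} {y} cx≡cy = ≤-antisym (level-minimal x (subst (Reached (level y)) (sym cx≡cy) (level-reached y)))
                                       (level-minimal y (subst (Reached (level x)) cx≡cy (level-reached x)))

  newly-linked : ∀ {c} → centre c ≡ c → c ≢ r → Linked (Reached (pred (level c))) c
  newly-linked {c} c-centre c≢r with level c | level-reached c | level-minimal c
  ... | zero  | reached      | _       = ⊥-elim (c≢r (trans (sym c-centre) reached))
  ... | suc k | inj₂ linked  | _       = subst (Linked (Reached k)) c-centre linked
  ... | suc k | inj₁ earlier | minimal = ⊥-elim (1+n≰n (minimal earlier))

  -- entry c and link c are meaningful for centres c ≢ r; the default c , c gives entry r ≡ r.
  private
    gateway : Fin n → Fin n × Fin n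
    gateway c with c ≟ r | centre c ≟ c
    ... | no c≢r | yes c-centre = let (w , _ , u , _) = newly-linked c-centre c≢r in w , u
    ... | _      | _            = c , c

  entry : Fin n → Fin n
  entry c = proj₁ (gateway c)

  link : Fin n → Fin n
  link c = proj₂ (gateway c)

  entry-root : entry r ≡ r
  entry-root with r ≟ r
  ... | yes _  = refl
  ... | no r≢r = ⊥-elim (r≢r refl)

  entry-spec : ∀ {c} → centre c ≡ c → c ≢ r →
               centre (entry c) ≡ c × Reached (pred (level c)) (centre (link c)) × adj G (link c) (entry c) ≡ true
  entry-spec {c} c-centre c≢r with c ≟ r | centre c ≟ c
  ... | yes c≡r | _            = ⊥-elim (c≢r c≡r)
  ... | no _    | no ¬c-centre = ⊥-elim (¬c-centre c-centre)
  ... | no c≢r′ | yes c-centre′ = let (_ , w∈c , _ , u-reached , uw) = newly-linked c-centre′ c≢r′ in w∈c , u-reached , uw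

  link-level : ∀ {c} → centre c ≡ c → c ≢ r → level (link c) < level c
  link-level {c} c-centre c≢r = ≤pred⇒< level≢0 (level-minimal (link c) (proj₁ (proj₂ (entry-spec c-centre c≢r))))
    where
    ≤pred⇒< : ∀ {m l} → l ≢ 0 → m ≤ pred l → m < l
    ≤pred⇒< {l = zero}  l≢0 _   = ⊥-elim (l≢0 refl)
    ≤pred⇒< {l = suc l} _   m≤l = s≤s m≤l
    level≢0 : level c ≢ 0
    level≢0 l≡0 = c≢r (trans (sym c-centre) (subst (λ k → Reached k (centre c)) l≡0 (level-reached c)))

  entry-cluster≢root : ∀ {v} → v ≢ r → v ≡ entry (centre v) → centre v ≢ r
  entry-cluster≢root v≢r v≡e c≡r = v≢r (trans v≡e (trans (cong entry c≡r) entry-root))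

  data Role (v : Fin n) : Set where
    is-root   : v ≡ r → Role v
    is-entry  : v ≢ r → v ≡ entry (centre v) → Role v
    is-centre : v ≢ entry (centre v) → v ≡ centre v → Role v
    is-leaf   : v ≢ entry (centre v) → v ≢ centre v → Role v

  role : ∀ v → Role v
  role v with v ≟ r | v ≟ entry (centre v) | v ≟ centre v
  ... | yes v≡r | _       | _       = is-root v≡r
  ... | no v≢r  | yes v≡e | _       = is-entry v≢r v≡e
  ... | no _    | no v≢e  | yes v≡c = is-centre v≢e v≡c
  ... | no _    | no v≢e  | no v≢c  = is-leaf v≢e v≢c

  -- Leaves hang from their centre, the centre from the entry vertex, and the entry from a lower
  -- cluster; so rank = 3 * level + offset decreases along parent.
  parent : Fin n → Fin n
  parent v with role v
  ... | is-root _     = r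
  ... | is-entry _ _  = link (centre v)
  ... | is-centre _ _ = entry (centre v)
  ... | is-leaf _ _   = centre v

  offset : Fin n → ℕ
  offset v with role v
  ... | is-root _     = 0
  ... | is-entry _ _  = 0
  ... | is-centre _ _ = 1
  ... | is-leaf _ _   = 2

  rank : Fin n → ℕ
  rank v = 3 * level v + offset v

  root≡entry : ∀ {v} → v ≡ r → v ≡ entry (centre v)
  root≡entry refl = sym (trans (cong entry centre-root) entry-root)

  parent-root : parent r ≡ r
  parent-root with role r
  ... | is-root _       = refl
  ... | is-entry r≢r _  = ⊥-elim (r≢r refl)
  ... | is-centre r≢e _ = ⊥-elim (r≢e (root≡entry refl))
  ... | is-leaf r≢e _   = ⊥-elim (r≢e (root≡entry refl))

  parent-centre : ∀ {v} → v ≢ entry (centre v) → v ≡ centre v → parent v ≡ entry (centre v)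
  parent-centre {v} v≢e v≡c with role v
  ... | is-root v≡r     = ⊥-elim (v≢e (root≡entry v≡r))
  ... | is-entry _ v≡e  = ⊥-elim (v≢e v≡e)
  ... | is-centre _ _   = refl
  ... | is-leaf _ v≢c   = ⊥-elim (v≢c v≡c)

  offset≤2 : ∀ v → offset v ≤ 2
  offset≤2 v with role v
  ... | is-root _     = z≤n
  ... | is-entry _ _  = z≤n
  ... | is-centre _ _ = s≤s z≤n
  ... | is-leaf _ _   = ≤-refl

  offset-entry : ∀ {v} → v ≡ entry (centre v) → offset v ≡ 0
  offset-entry {v} v≡e with role v
  ... | is-root _       = refl
  ... | is-entry _ _    = refl
  ... | is-centre v≢e _ = ⊥-elim (v≢e v≡e)
  ... | is-leaf v≢e _   = ⊥-elim (v≢e v≡e)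

  offset-centre : ∀ {v} → v ≡ centre v → offset v ≤ 1
  offset-centre {v} v≡c with role v
  ... | is-root _     = z≤n
  ... | is-entry _ _  = z≤n
  ... | is-centre _ _ = ≤-refl
  ... | is-leaf _ v≢c = ⊥-elim (v≢c v≡c)

  rank-below : ∀ {u} l o → level u < l → rank u < 3 * l + o
  rank-below {u} l o lu<l = begin-strict
    3 * level u + offset u ≤⟨ +-monoʳ-≤ (3 * level u) (offset≤2 u) ⟩
    3 * level u + 2        <⟨ +-monoʳ-< (3 * level u) (n<1+n 2) ⟩
    3 * level u + 3        ≡⟨ +-comm (3 * level u) 3 ⟩
    3 + 3 * level u        ≡⟨ sym (*-suc 3 (level u)) ⟩
    3 * suc (level u)      ≤⟨ *-monoʳ-≤ 3 lu<l ⟩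
    3 * l                  ≤⟨ m≤m+n (3 * l) o ⟩
    3 * l + o              ∎
    where open ≤-Reasoning

  rank-within : ∀ {u} l o → level u ≡ l → offset u < o → rank u < 3 * l + o
  rank-within {u} l o refl = +-monoʳ-< (3 * l)

  parent-spec : ∀ v → v ≢ r → adj G v (parent v) ≡ true × rank (parent v) < rank v
  parent-spec v v≢r with role v
  ... | is-root v≡r = ⊥-elim (v≢r v≡r)
  ... | is-entry _ v≡e =
    Graph.sym G (link (centre v)) v (subst (λ x → adj G (link (centre v)) x ≡ true) (sym v≡e) link-adj) ,
    rank-below (level v) 0 (subst (level (link (centre v)) <_) (level-cong (centre-idem v)) (link-level (centre-idem v) c≢r))
    where
    c≢r : centre v ≢ r
    c≢r = entry-cluster≢root v≢r v≡e
    link-adj : adj G (link (centre v)) (entry (centre v)) ≡ true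
    link-adj = proj₂ (proj₂ (entry-spec (centre-idem v) c≢r))
  ... | is-centre v≢e v≡c =
    subst (λ x → adj G x (entry (centre v)) ≡ true) (trans e∈c (sym v≡c)) (centre-adj (≢centre⇒∉S e≢centre)) ,
    rank-within (level v) 1 (level-cong e∈c) (s≤s (≤-reflexive (offset-entry (cong entry (sym e∈c)))))
    where
    c≢r : centre v ≢ r
    c≢r c≡r = v≢e (root≡entry (trans v≡c c≡r))
    e∈c : centre (entry (centre v)) ≡ centre v
    e∈c = proj₁ (entry-spec (centre-idem v) c≢r)
    e≢centre : entry (centre v) ≢ centre (entry (centre v))
    e≢centre e≡c = v≢e (trans v≡c (sym (trans e≡c e∈c)))
  ... | is-leaf v≢e v≢c =
    Graph.sym G (centre v) v (centre-adj (≢centre⇒∉S v≢c)) ,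
    rank-within (level v) 2 (level-cong (centre-idem v)) (s≤s (offset-centre (sym (centre-idem v))))

  open RootedTree r parent parent-root rank (λ v v≢r → proj₂ (parent-spec v v≢r)) public

  tree-dominated : ∀ v → S v ≡ false → ∃ λ s → S s ≡ true × (Child s v ⊎ Child v s)
  tree-dominated v v∉S with role v
  ... | is-root refl      = ⊥-elim (true≢false r∈S v∉S)
  ... | is-centre _ v≡c   = ⊥-elim (true≢false (trans (cong S v≡c) (centre-∈S v)) v∉S)
  ... | is-leaf _ v≢c     = centre v , centre-∈S v , inj₂ (v≢r , refl)
    where
    v≢r : v ≢ r
    v≢r refl = true≢false r∈S v∉S
  ... | is-entry v≢r v≡e  =
    centre v , centre-∈S v , inj₁ (entry-cluster≢root v≢r v≡e , trans (parent-centre c≢e (sym (centre-idem v))) e≡v)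
    where
    e≡v : entry (centre (centre v)) ≡ v
    e≡v = trans (cong entry (centre-idem v)) (sym v≡e)
    c≢e : centre v ≢ entry (centre (centre v))
    c≢e c≡e = true≢false (centre-∈S v) (subst (λ x → S x ≡ false) (sym (trans c≡e e≡v)) v∉S)

  dominated-unicyclic-subgraph : ¬ Bipartite G →
    Σ (Graph n) λ H → SpanningSubgraph H G × Unicyclic H × ¬ Bipartite H × Dominating H S
  dominated-unicyclic-subgraph not-bipartite with monochromatic-edge G (odd ∘ depth) not-bipartite
  ... | a , b , ab∈G , same-parity =
    H , H-spanning G (λ v v≢r → proj₁ (parent-spec v v≢r)) ab∈G , H-unicyclic , H-nonBipartite same-parity , H-dominated
    where
    a≢b : a ≢ b
    a≢b refl = true≢false ab∈G (irref G a)
    open TreeWithEdge a b a≢b (same-parity⇒¬parent same-parity a≢b) (same-parity⇒¬parent (sym same-parity) (a≢b ∘ sym))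
    H-dominated : Dominating H S
    H-dominated v v∉S with tree-dominated v v∉S
    ... | s , s∈S , inj₁ s↑v = s , s∈S , ⇒adjᴴ (up s↑v)
    ... | s , s∈S , inj₂ v↑s = s , s∈S , ⇒adjᴴ (down v↑s)

dominated-unicyclic-spanning-subgraph : ∀ {n} (G : Graph n) → Connected G → ¬ Bipartite G → ∀ S → Dominating G S →
  Σ (Graph n) λ H → SpanningSubgraph H G × Unicyclic H × ¬ Bipartite H × Dominating H S
dominated-unicyclic-spanning-subgraph {zero}  G _         not-bipartite S _     = ⊥-elim (not-bipartite ((λ ()) , λ ()))
dominated-unicyclic-spanning-subgraph {suc n} G connected not-bipartite S S-dom =
  DominatedSpanningTree.dominated-unicyclic-subgraph G connected S S-dom (centre zero) (centre-∈S zero) not-bipartite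
  where open Clusters G S S-dom

lemma3p7 : (n : ℕ) (G : Graph n) (γ : ℕ) →
    Connected G → ¬ Bipartite G → DominationNumber G γ →
    Σ (Graph n) λ H →
      SpanningSubgraph H G × Unicyclic H × ¬ Bipartite H × DominationNumber H γ
lemma3p7 n G γ connected not-bipartite γ-G@((S , S-dom , |S|≡γ) , _) =
  let (H , H⊆G , H-unicyclic , H-nonBipartite , S-dom-H) = dominated-unicyclic-spanning-subgraph G connected not-bipartite S S-dom
  in H , H⊆G , H-unicyclic , H-nonBipartite , domination-number-spanning {G = G} {H = H} H⊆G γ-G S-dom-H |S|≡γ
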